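{- Let $B$ be a finite Boolean algebra and let the $N$ variables $X$ be partitioned as $X=(X_1,X_2)$ with $X_1$ of size $n_1\ge1$ and $X_2$ of size $n_2$. Let $M_1,\ldots,M_{m_1}$ be nonempty pairwise disjoint sets with union $\{0,\ldots,2^{n_1}-1\}$ and let $\phi_i(X_1)=\sum_{j\in M_i}\mu_j(X_1)$, where $\mu_j(X_1)$ are the minterms in the variables $X_1$. Suppose $f\in B(N)$ has an expansion $f(X)=\sum_{i=1}^{m_1}\alpha_i(X_2)\phi_i(X_1)$ where each $\alpha_i$ is a Boolean function of the variables $X_2$ only. Then $f(X)=0$ is consistent if and only if the equation $\prod_{i=1}^{m_1}\alpha_i(X_2)=0$ is consistent.
   Context: $B(N)$ denotes the Boolean algebra of Boolean functions $B^N\to B$. Minterms in variables $y_1,\ldots,y_k$ are the $2^k$ products $y_1^{j_1}\cdots y_k^{j_k}$ with $y^1=y$, $y^0=y'$. An equation $g=0$ is consistent if it has a solution with values of the variables in $B$. -}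

module Defs where

open import Level using (Level)
open import Data.Nat using (ℕ; zero; suc; _^_; _/_; _%_; _≡ᵇ_)
open import Data.Fin using (Fin; toℕ)
import Data.Fin as F
open import Data.Bool using (Bool; true; false; if_then_else_)
open import Data.Vec using (lookup)
open import Data.Fin.Subset using (Subset)
open import Data.Product using (Σ; ∃; _×_)
open import Algebra.Lattice.Bundles using (BooleanAlgebra)

IsFinite : ∀ {c ℓ} → BooleanAlgebra c ℓ → Set _
IsFinite BA = Σ ℕ λ k → Σ (Fin k → Carrier) λ enum → ∀ b → ∃ λ j → enum j ≈ b
  where open BooleanAlgebra BA

module BoolFun {c ℓ} (BA : BooleanAlgebra c ℓ) where
  open BooleanAlgebra BA

  data Formula (n : ℕ) : Set c where
    const : Carrier → Formula n
    var   : Fin n → Formula n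
    _or_  : Formula n → Formula n → Formula n
    _and_ : Formula n → Formula n → Formula n
    neg   : Formula n → Formula n

  eval : ∀ {n} → Formula n → (Fin n → Carrier) → Carrier
  eval (const a) x = a
  eval (var k)   x = x k
  eval (s or t)  x = eval s x ∨ eval t x
  eval (s and t) x = eval s x ∧ eval t x
  eval (neg t)   x = ¬ eval t x

  IsBooleanFunction : ∀ {n} → ((Fin n → Carrier) → Carrier) → Set (c Level.⊔ ℓ)
  IsBooleanFunction {n} f = Σ (Formula n) λ t → ∀ x → f x ≈ eval t x

  ⋁ : ∀ {n} → (Fin n → Carrier) → Carrier
  ⋁ {zero}  g = ⊥
  ⋁ {suc n} g = g F.zero ∨ ⋁ (λ i → g (F.suc i))

  ⋀ : ∀ {n} → (Fin n → Carrier) → Carrier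
  ⋀ {zero}  g = ⊤
  ⋀ {suc n} g = g F.zero ∧ ⋀ (λ i → g (F.suc i))

  bitℕ : ℕ → ℕ → Bool
  bitℕ a zero    = (a % 2) ≡ᵇ 1
  bitℕ a (suc k) = bitℕ (a / 2) k

  bit : ∀ {m} → Fin m → ℕ → Bool
  bit j k = bitℕ (toℕ j) k

  power : Carrier → Bool → Carrier
  power y true  = y
  power y false = ¬ y

  -- minterm μ_j(y_1..y_n) = y_1^{j_1} ⋯ y_n^{j_n}, where j_k is the k-th
  -- binary digit of j (variable y_k, k = 0..n-1, gets digit k)
  minterm : ∀ {n} → Fin (2 ^ n) → (Fin n → Carrier) → Carrier
  minterm j y = ⋀ (λ k → power (y k) (bit j (toℕ k)))

  φ : ∀ {n} → Subset (2 ^ n) → (Fin n → Carrier) → Carrier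
  φ M y = ⋁ (λ j → if lookup M j then minterm j y else ⊥)

-- Both directions rest on one fact about Boolean functions G: they commute with
-- restriction, β ∧ G x ≈ β ∧ G y whenever β ∧ x k ≈ β ∧ y k for all k.
-- Expanding along the first variable then shows that G ≈ ⊤ as soon as G is ⊤ at
-- every 0/1 point; so the φ_i, which cover all minterms, sum to ⊤, and
-- ⋀ α ≈ ⋀ α ∧ ⋁ φ_i ≤ ⋁ α_i ∧ φ_i ≈ f.  Conversely, if ⋀ α(x₂) ≈ ⊥, the elements
-- ¬ α_i(x₂) cover ⊤ and refine to a partition β_i with β_i ∧ α_i(x₂) ≈ ⊥.  Gluing
-- together, along this partition, 0/1 points u_i that pick a minterm of M_i gives
-- x₁ with β_i ∧ φ_{i′}(x₁) ≈ β_i ∧ φ_{i′}(u_i), which vanishes for i′ ≢ i by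
-- disjointness, and hence f(x₁, x₂) ≈ ⊥.
module Submission where

open import Defs
open import Level using (Level; _⊔_)
open import Data.Nat using (ℕ; zero; suc; _+_; _*_; _<_; _^_; _/_; _%_; _≡ᵇ_; _≥_; z≤n; s≤s)
open import Data.Nat.Properties using (*-comm; *-monoˡ-≤; +-monoˡ-≤; n<1⇒n≡0; module ≤-Reasoning)
open import Data.Nat.DivMod
  using (m≡m%n+[m/n]*n; m%n<n; [m+kn]%n≡m%n; m<n⇒m%n≡m; +-distrib-/-∣ʳ; m*n/n≡m; m<n⇒m/n≡0; m<n*o⇒m/o<n)
open import Data.Nat.Divisibility using (divides-refl)
open import Data.Fin using (Fin; toℕ; fromℕ<; splitAt; join)
import Data.Fin as F
open import Data.Fin.Properties using (toℕ<n; toℕ-fromℕ<; toℕ-injective; suc-injective; ¬∀⟶∃¬; join-splitAt)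
open import Data.Fin.Subset using (Subset; _∈_; _∉_; _∩_; Nonempty; Empty)
open import Data.Fin.Subset.Properties using (x∈p∩q⁺)
open import Data.Bool using (Bool; true; false; if_then_else_)
import Data.Bool.Properties as Bool
open import Data.Vec using (lookup)
open import Data.Vec.Properties using ([]=⇒lookup; lookup⇒[]=)
open import Data.Vec.Functional using (Vector; _∷_; head; tail; _++_; take; drop)
open import Data.Sum using (inj₁; inj₂; [_,_]′)
open import Data.Product using (∃; _,_; proj₁; proj₂)
open import Data.Empty using (⊥-elim)
open import Relation.Nullary using (yes; no)
open import Relation.Binary.PropositionalEquality as ≡ using (_≡_; _≢_)
open import Function.Base using (_∘_)
open import Function.Bundles using (_⇔_; mk⇔)
open import Algebra.Lattice.Bundles using (BooleanAlgebra)

take++drop : ∀ {a} {A : Set a} m {n} (x : Vector A (m + n)) k → (take m x ++ drop m x) k ≡ x k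
take++drop m {n} x k = ≡.trans (split (splitAt m k)) (≡.cong x (join-splitAt m n k))
  where
  split : ∀ s → [ take m x , drop m x ]′ s ≡ x (join m n s)
  split (inj₁ _) = ≡.refl
  split (inj₂ _) = ≡.refl

module BooleanFunctions {c ℓ} (BA : BooleanAlgebra c ℓ) where
  open BooleanAlgebra BA
  open BoolFun BA

  bitValue : Bool → ℕ
  bitValue false = 0
  bitValue true  = 1

  bitValue<2 : ∀ b → bitValue b < 2
  bitValue<2 false = s≤s z≤n
  bitValue<2 true  = s≤s (s≤s z≤n)

  fromBitsℕ : ∀ n → Vector Bool n → ℕ
  fromBitsℕ zero    b = 0
  fromBitsℕ (suc n) b = bitValue (head b) + fromBitsℕ n (tail b) * 2

  fromBitsℕ<2^n : ∀ n b → fromBitsℕ n b < 2 ^ n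
  fromBitsℕ<2^n zero    b = s≤s z≤n
  fromBitsℕ<2^n (suc n) b = begin-strict
    bitValue (head b) + fromBitsℕ n (tail b) * 2 <⟨ +-monoˡ-≤ _ (bitValue<2 (head b)) ⟩
    2 + fromBitsℕ n (tail b) * 2                 ≤⟨ *-monoˡ-≤ 2 (fromBitsℕ<2^n n (tail b)) ⟩
    2 ^ n * 2                                    ≡⟨ *-comm (2 ^ n) 2 ⟩
    2 ^ suc n                                    ∎
    where open ≤-Reasoning

  lowestDigit : ∀ b y → (bitValue b + y * 2) % 2 ≡ bitValue b
  lowestDigit b y = ≡.trans ([m+kn]%n≡m%n (bitValue b) y 2) (m<n⇒m%n≡m (bitValue<2 b))

  higherDigits : ∀ b y → (bitValue b + y * 2) / 2 ≡ y
  higherDigits b y = ≡.trans (+-distrib-/-∣ʳ (bitValue b) (divides-refl y))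
                             (≡.cong₂ _+_ (m<n⇒m/n≡0 (bitValue<2 b)) (m*n/n≡m y 2))

  bitValue≡ᵇ1 : ∀ b → (bitValue b ≡ᵇ 1) ≡ b
  bitValue≡ᵇ1 false = ≡.refl
  bitValue≡ᵇ1 true  = ≡.refl

  bitℕ-fromBitsℕ : ∀ n b (k : Fin n) → bitℕ (fromBitsℕ n b) (toℕ k) ≡ b k
  bitℕ-fromBitsℕ (suc n) b F.zero =
    ≡.trans (≡.cong (_≡ᵇ 1) (lowestDigit (head b) (fromBitsℕ n (tail b)))) (bitValue≡ᵇ1 (head b))
  bitℕ-fromBitsℕ (suc n) b (F.suc k) =
    ≡.trans (≡.cong (λ a → bitℕ a (toℕ k)) (higherDigits (head b) (fromBitsℕ n (tail b)))) (bitℕ-fromBitsℕ n (tail b) k)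

  bitℕ-injective : ∀ n {a c} → a < 2 ^ n → c < 2 ^ n →
                   (∀ (k : Fin n) → bitℕ a (toℕ k) ≡ bitℕ c (toℕ k)) → a ≡ c
  bitℕ-injective zero    a<1 c<1 _ = ≡.trans (n<1⇒n≡0 a<1) (≡.sym (n<1⇒n≡0 c<1))
  bitℕ-injective (suc n) {a} {c} a< c< same = begin
    a                  ≡⟨ m≡m%n+[m/n]*n a 2 ⟩
    a % 2 + a / 2 * 2  ≡⟨ ≡.cong₂ (λ r q → r + q * 2) lowest rest ⟩
    c % 2 + c / 2 * 2  ≡⟨ m≡m%n+[m/n]*n c 2 ⟨
    c                  ∎
    where
    open ≡.≡-Reasoning
    digit-injective : ∀ {x y} → x < 2 → y < 2 → (x ≡ᵇ 1) ≡ (y ≡ᵇ 1) → x ≡ y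
    digit-injective {0} {0} _ _ _  = ≡.refl
    digit-injective {1} {1} _ _ _  = ≡.refl
    digit-injective {0} {1} _ _ ()
    digit-injective {1} {0} _ _ ()
    digit-injective {suc (suc _)} (s≤s (s≤s ())) _
    digit-injective {_} {suc (suc _)} _ (s≤s (s≤s ()))
    halve : ∀ {x} → x < 2 ^ suc n → x / 2 < 2 ^ n
    halve {x} x< = m<n*o⇒m/o<n (≡.subst (x <_) (*-comm 2 (2 ^ n)) x<)
    lowest : a % 2 ≡ c % 2
    lowest = digit-injective (m%n<n a 2) (m%n<n c 2) (same F.zero)
    rest : a / 2 ≡ c / 2
    rest = bitℕ-injective n (halve a<) (halve c<) (λ k → same (F.suc k))

  bits : ∀ {n} → Fin (2 ^ n) → Vector Bool n
  bits j k = bit j (toℕ k)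

  fromBits : ∀ {n} → Vector Bool n → Fin (2 ^ n)
  fromBits {n} b = fromℕ< (fromBitsℕ<2^n n b)

  bits-fromBits : ∀ {n} (b : Vector Bool n) k → bits (fromBits b) k ≡ b k
  bits-fromBits {n} b k rewrite toℕ-fromℕ< (fromBitsℕ<2^n n b) = bitℕ-fromBitsℕ n b k

  bits-injective : ∀ {n} {j j′ : Fin (2 ^ n)} → (∀ k → bits j k ≡ bits j′ k) → j ≡ j′
  bits-injective {n} {j} {j′} same = toℕ-injective (bitℕ-injective n (toℕ<n j) (toℕ<n j′) same)

  open import Algebra.Lattice.Properties.BooleanAlgebra BA
  open import Relation.Binary.Reasoning.Setoid setoid

  ⋁-cong : ∀ {n} {g h : Vector Carrier n} → (∀ i → g i ≈ h i) → ⋁ g ≈ ⋁ h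
  ⋁-cong {zero}  e = refl
  ⋁-cong {suc n} e = ∨-cong (e F.zero) (⋁-cong (λ i → e (F.suc i)))

  ∧-distribˡ-⋁ : ∀ {n} a (g : Vector Carrier n) → a ∧ ⋁ g ≈ ⋁ (λ i → a ∧ g i)
  ∧-distribˡ-⋁ {zero}  a g = ∧-zeroʳ a
  ∧-distribˡ-⋁ {suc n} a g = trans (∧-distribˡ-∨ a _ _) (∨-congˡ (∧-distribˡ-⋁ a (tail g)))

  ∧-distribʳ-⋁ : ∀ {n} a (g : Vector Carrier n) → ⋁ g ∧ a ≈ ⋁ (λ i → g i ∧ a)
  ∧-distribʳ-⋁ a g = trans (∧-comm _ _) (trans (∧-distribˡ-⋁ a g) (⋁-cong (λ i → ∧-comm a (g i))))

  ⋁≈⊥⁺ : ∀ {n} {g : Vector Carrier n} → (∀ i → g i ≈ ⊥) → ⋁ g ≈ ⊥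
  ⋁≈⊥⁺ {zero}  e = refl
  ⋁≈⊥⁺ {suc n} e = trans (∨-cong (e F.zero) (⋁≈⊥⁺ (λ i → e (F.suc i)))) (∨-identityʳ ⊥)

  x∨y≈⊥⇒x≈⊥ : ∀ x y → x ∨ y ≈ ⊥ → x ≈ ⊥
  x∨y≈⊥⇒x≈⊥ x y e = begin
    x            ≈⟨ ∧-absorbs-∨ x y ⟨
    x ∧ (x ∨ y)  ≈⟨ ∧-congˡ e ⟩
    x ∧ ⊥        ≈⟨ ∧-zeroʳ x ⟩
    ⊥            ∎

  ⋁≈⊥⁻ : ∀ {n} {g : Vector Carrier n} → ⋁ g ≈ ⊥ → ∀ i → g i ≈ ⊥
  ⋁≈⊥⁻ {suc n} e F.zero    = x∨y≈⊥⇒x≈⊥ _ _ e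
  ⋁≈⊥⁻ {suc n} e (F.suc i) = ⋁≈⊥⁻ (x∨y≈⊥⇒x≈⊥ _ _ (trans (∨-comm _ _) e)) i

  ⋁≈⊤ : ∀ {n} {g : Vector Carrier n} i → g i ≈ ⊤ → ⋁ g ≈ ⊤
  ⋁≈⊤ F.zero    e = trans (∨-congʳ e) (∨-zeroˡ _)
  ⋁≈⊤ (F.suc i) e = trans (∨-congˡ (⋁≈⊤ i e)) (∨-zeroʳ _)

  ⋁-single : ∀ {n} {g : Vector Carrier n} i → (∀ i′ → i′ ≢ i → g i′ ≈ ⊥) → ⋁ g ≈ g i
  ⋁-single F.zero    e = trans (∨-congˡ (⋁≈⊥⁺ (λ i′ → e (F.suc i′) λ ()))) (∨-identityʳ _)
  ⋁-single (F.suc i) e =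
    trans (∨-cong (e F.zero λ ()) (⋁-single i (λ i′ i′≢i → e (F.suc i′) (i′≢i ∘ suc-injective))))
          (∨-identityˡ _)

  ⋀≈⊤ : ∀ {n} {g : Vector Carrier n} → (∀ i → g i ≈ ⊤) → ⋀ g ≈ ⊤
  ⋀≈⊤ {zero}  e = refl
  ⋀≈⊤ {suc n} e = trans (∧-cong (e F.zero) (⋀≈⊤ (λ i → e (F.suc i)))) (∧-identityʳ ⊤)

  ⋀∧≈⋀ : ∀ {n} (g : Vector Carrier n) i → ⋀ g ∧ g i ≈ ⋀ g
  ⋀∧≈⋀ g F.zero = begin
    (g F.zero ∧ ⋀ (tail g)) ∧ g F.zero  ≈⟨ ∧-comm _ _ ⟩
    g F.zero ∧ (g F.zero ∧ ⋀ (tail g))  ≈⟨ ∧-assoc _ _ _ ⟨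
    (g F.zero ∧ g F.zero) ∧ ⋀ (tail g)  ≈⟨ ∧-congʳ (∧-idem _) ⟩
    g F.zero ∧ ⋀ (tail g)               ∎
  ⋀∧≈⋀ g (F.suc i) = trans (∧-assoc _ _ _) (∧-congˡ (⋀∧≈⋀ (tail g) i))

  ⋀≈⊥ : ∀ {n} {g : Vector Carrier n} i → g i ≈ ⊥ → ⋀ g ≈ ⊥
  ⋀≈⊥ {g = g} i e = trans (sym (⋀∧≈⋀ g i)) (trans (∧-congˡ e) (∧-zeroʳ _))

  ¬-⋀ : ∀ {n} (g : Vector Carrier n) → ¬ ⋀ g ≈ ⋁ (λ i → ¬ g i)
  ¬-⋀ {zero}  g = ¬⊤≈⊥
  ¬-⋀ {suc n} g = trans (deMorgan₁ _ _) (∨-congˡ (¬-⋀ (tail g)))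

  -- Equality below β

  _≈[_]_ : Carrier → Carrier → Carrier → Set ℓ
  x ≈[ β ] y = β ∧ x ≈ β ∧ y

  ∧-distribˡ-∧ : ∀ β x y → β ∧ (x ∧ y) ≈ (β ∧ x) ∧ (β ∧ y)
  ∧-distribˡ-∧ β x y = sym (begin
    (β ∧ x) ∧ (β ∧ y)  ≈⟨ ∧-assoc β x (β ∧ y) ⟩
    β ∧ (x ∧ (β ∧ y))  ≈⟨ ∧-congˡ (∧-assoc x β y) ⟨
    β ∧ ((x ∧ β) ∧ y)  ≈⟨ ∧-congˡ (∧-congʳ (∧-comm x β)) ⟩
    β ∧ ((β ∧ x) ∧ y)  ≈⟨ ∧-congˡ (∧-assoc β x y) ⟩
    β ∧ (β ∧ (x ∧ y))  ≈⟨ ∧-assoc β β (x ∧ y) ⟨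
    (β ∧ β) ∧ (x ∧ y)  ≈⟨ ∧-congʳ (∧-idem β) ⟩
    β ∧ (x ∧ y)        ∎)

  ∧-¬-∧ : ∀ β x → β ∧ ¬ x ≈ β ∧ ¬ (β ∧ x)
  ∧-¬-∧ β x = sym (begin
    β ∧ ¬ (β ∧ x)          ≈⟨ ∧-congˡ (deMorgan₁ β x) ⟩
    β ∧ (¬ β ∨ ¬ x)        ≈⟨ ∧-distribˡ-∨ β (¬ β) (¬ x) ⟩
    (β ∧ ¬ β) ∨ (β ∧ ¬ x)  ≈⟨ ∨-congʳ (∧-complementʳ β) ⟩
    ⊥ ∨ (β ∧ ¬ x)          ≈⟨ ∨-identityˡ _ ⟩
    β ∧ ¬ x                ∎)

  ≈[]-∧ : ∀ {β x y x′ y′} → x ≈[ β ] y → x′ ≈[ β ] y′ → (x ∧ x′) ≈[ β ] (y ∧ y′)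
  ≈[]-∧ {β} {x} {y} {x′} {y′} e e′ =
    trans (∧-distribˡ-∧ β x x′) (trans (∧-cong e e′) (sym (∧-distribˡ-∧ β y y′)))

  ≈[]-∨ : ∀ {β x y x′ y′} → x ≈[ β ] y → x′ ≈[ β ] y′ → (x ∨ x′) ≈[ β ] (y ∨ y′)
  ≈[]-∨ {β} {x} {y} {x′} {y′} e e′ =
    trans (∧-distribˡ-∨ β x x′) (trans (∨-cong e e′) (sym (∧-distribˡ-∨ β y y′)))

  ≈[]-¬ : ∀ {β x y} → x ≈[ β ] y → (¬ x) ≈[ β ] (¬ y)
  ≈[]-¬ {β} {x} {y} e = trans (∧-¬-∧ β x) (trans (∧-congˡ (¬-cong e)) (sym (∧-¬-∧ β y)))

  ≈[]-⋁ : ∀ {n β} {g h : Vector Carrier n} → (∀ i → g i ≈[ β ] h i) → ⋁ g ≈[ β ] ⋁ h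
  ≈[]-⋁ {zero}  e = refl
  ≈[]-⋁ {suc n} e = ≈[]-∨ (e F.zero) (≈[]-⋁ (λ i → e (F.suc i)))

  ≈[]-⋀ : ∀ {n β} {g h : Vector Carrier n} → (∀ i → g i ≈[ β ] h i) → ⋀ g ≈[ β ] ⋀ h
  ≈[]-⋀ {zero}  e = refl
  ≈[]-⋀ {suc n} e = ≈[]-∧ (e F.zero) (≈[]-⋀ (λ i → e (F.suc i)))

  -- Functions commuting with restriction

  Local : ∀ {n} → (Vector Carrier n → Carrier) → Set (c ⊔ ℓ)
  Local G = ∀ β x y → (∀ k → x k ≈[ β ] y k) → G x ≈[ β ] G y

  Local⇒cong : ∀ {n} {G : Vector Carrier n → Carrier} → Local G →
               ∀ {x y} → (∀ k → x k ≈ y k) → G x ≈ G y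
  Local⇒cong local {x} {y} x≈y =
    trans (sym (∧-identityˡ _)) (trans (local ⊤ x y ≈[⊤]) (∧-identityˡ _))
    where
    ≈[⊤] : ∀ k → x k ≈[ ⊤ ] y k
    ≈[⊤] k = trans (∧-identityˡ _) (trans (x≈y k) (sym (∧-identityˡ _)))

  Local-∷ : ∀ {n} {G : Vector Carrier (suc n) → Carrier} → Local G → ∀ a → Local (λ x → G (a ∷ x))
  Local-∷ local a β x y x≈y = local β (a ∷ x) (a ∷ y) λ { F.zero → refl ; (F.suc k) → x≈y k }

  eval-local : ∀ {n} (t : Formula n) → Local (eval t)
  eval-local (const a) β x y x≈y = refl
  eval-local (var k)   β x y x≈y = x≈y k
  eval-local (s or t)  β x y x≈y = ≈[]-∨ (eval-local s β x y x≈y) (eval-local t β x y x≈y)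
  eval-local (s and t) β x y x≈y = ≈[]-∧ (eval-local s β x y x≈y) (eval-local t β x y x≈y)
  eval-local (neg t)   β x y x≈y = ≈[]-¬ (eval-local t β x y x≈y)

  BooleanFunction-cong : ∀ {n} {f : Vector Carrier n → Carrier} → IsBooleanFunction f →
                         ∀ {x y} → (∀ k → x k ≈ y k) → f x ≈ f y
  BooleanFunction-cong (t , f≈t) x≈y = trans (f≈t _) (trans (Local⇒cong (eval-local t) x≈y) (sym (f≈t _)))

  power-local : ∀ {β x y} b → x ≈[ β ] y → power x b ≈[ β ] power y b
  power-local true  e = e
  power-local false e = ≈[]-¬ e

  minterm-local : ∀ {n} (j : Fin (2 ^ n)) → Local (minterm j)
  minterm-local {n} j β x y x≈y = ≈[]-⋀ {n} (λ k → power-local (bits {n} j k) (x≈y k))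

  φ-local : ∀ {n} (M : Subset (2 ^ n)) → Local (φ M)
  φ-local {n} M β x y x≈y = ≈[]-⋁ {2 ^ n} λ j → selected (lookup M j) (minterm-local {n} j β x y x≈y)
    where
    selected : ∀ {u v} b → u ≈[ β ] v → (if b then u else ⊥) ≈[ β ] (if b then v else ⊥)
    selected true  e = e
    selected false e = refl

  -- Verification on 0/1 points

  toCarrier : Bool → Carrier
  toCarrier b = if b then ⊤ else ⊥

  corner : ∀ {n} → Vector Bool n → Vector Carrier n
  corner b k = toCarrier (b k)

  expansion : ∀ {n} {G : Vector Carrier (suc n) → Carrier} → Local G → ∀ x →
              G x ≈ (head x ∧ G (⊤ ∷ tail x)) ∨ (¬ head x ∧ G (⊥ ∷ tail x))
  expansion {G = G} local x = begin
    G x                                              ≈⟨ ∧-identityˡ _ ⟨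
    ⊤ ∧ G x                                          ≈⟨ ∧-congʳ (∨-complementʳ x₀) ⟨
    (x₀ ∨ ¬ x₀) ∧ G x                                ≈⟨ ∧-distribʳ-∨ (G x) x₀ (¬ x₀) ⟩
    (x₀ ∧ G x) ∨ (¬ x₀ ∧ G x)                        ≈⟨ ∨-cong (local x₀ _ _ below) (local (¬ x₀) _ _ below¬) ⟩
    (x₀ ∧ G (⊤ ∷ tail x)) ∨ (¬ x₀ ∧ G (⊥ ∷ tail x))  ∎
    where
    x₀ : Carrier
    x₀ = head x
    below : ∀ k → x k ≈[ x₀ ] (⊤ ∷ tail x) k
    below F.zero    = trans (∧-idem x₀) (sym (∧-identityʳ x₀))
    below (F.suc k) = refl
    below¬ : ∀ k → x k ≈[ ¬ x₀ ] (⊥ ∷ tail x) k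
    below¬ F.zero    = trans (∧-complementˡ x₀) (sym (∧-zeroʳ _))
    below¬ (F.suc k) = refl

  ≈⊤-from-corners : ∀ {n} {G : Vector Carrier n → Carrier} → Local G →
                    (∀ b → G (corner b) ≈ ⊤) → ∀ x → G x ≈ ⊤
  ≈⊤-from-corners {zero}  local atCorners x = trans (Local⇒cong local λ ()) (atCorners λ ())
  ≈⊤-from-corners {suc n} {G} local atCorners x = begin
    G x                                                      ≈⟨ expansion local x ⟩
    (head x ∧ G (⊤ ∷ tail x)) ∨ (¬ head x ∧ G (⊥ ∷ tail x))  ≈⟨ ∨-cong (∧-congˡ (fixed true)) (∧-congˡ (fixed false)) ⟩
    (head x ∧ ⊤) ∨ (¬ head x ∧ ⊤)                            ≈⟨ ∨-cong (∧-identityʳ _) (∧-identityʳ _) ⟩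
    head x ∨ ¬ head x                                        ≈⟨ ∨-complementʳ _ ⟩
    ⊤                                                        ∎
    where
    fixed : ∀ b → G (toCarrier b ∷ tail x) ≈ ⊤
    fixed b = ≈⊤-from-corners (Local-∷ local (toCarrier b))
      (λ bs → trans (Local⇒cong local λ { F.zero → refl ; (F.suc k) → refl }) (atCorners (b ∷ bs)))
      (tail x)

  power-same : ∀ b → power (toCarrier b) b ≈ ⊤
  power-same true  = refl
  power-same false = ¬⊥≈⊤

  power-diff : ∀ {b b′} → b ≢ b′ → power (toCarrier b) b′ ≈ ⊥
  power-diff {true}  {true}  b≢b′ = ⊥-elim (b≢b′ ≡.refl)
  power-diff {false} {false} b≢b′ = ⊥-elim (b≢b′ ≡.refl)
  power-diff {true}  {false} _    = ¬⊤≈⊥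
  power-diff {false} {true}  _    = refl

  minterm-fromBits : ∀ {n} (b : Vector Bool n) → minterm (fromBits b) (corner b) ≈ ⊤
  minterm-fromBits {n} b = ⋀≈⊤ {n} λ k →
    ≡.subst (λ d → power (corner b k) d ≈ ⊤) (≡.sym (bits-fromBits b k)) (power-same (b k))

  minterm≈⊥ : ∀ {n} {j : Fin (2 ^ n)} {b : Vector Bool n} k → bits j k ≢ b k → minterm j (corner b) ≈ ⊥
  minterm≈⊥ {n} k differ = ⋀≈⊥ {n} k (power-diff (differ ∘ ≡.sym))

  φ-corner≈⊤ : ∀ {n} {M : Subset (2 ^ n)} {b : Vector Bool n} → fromBits b ∈ M → φ M (corner b) ≈ ⊤
  φ-corner≈⊤ {n} {M} {b} j∈M = ⋁≈⊤ {2 ^ n} {λ j → if lookup M j then minterm j (corner b) else ⊥} (fromBits b) selected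
    where
    selected : (if lookup M (fromBits b) then minterm (fromBits b) (corner b) else ⊥) ≈ ⊤
    selected rewrite []=⇒lookup j∈M = minterm-fromBits b

  φ-corner≈⊥ : ∀ {n} {M : Subset (2 ^ n)} {j′ : Fin (2 ^ n)} → j′ ∉ M → φ M (corner (bits {n} j′)) ≈ ⊥
  φ-corner≈⊥ {n} {M} {j′} j′∉M = ⋁≈⊥⁺ {2 ^ n} {λ j → if lookup M j then minterm j (corner (bits {n} j′)) else ⊥} unselected
    where
    unselected : ∀ j → (if lookup M j then minterm j (corner (bits {n} j′)) else ⊥) ≈ ⊥
    unselected j with lookup M j in j∈M
    ... | false = refl
    ... | true  with ¬∀⟶∃¬ n (λ k → bits j k ≡ bits j′ k) (λ k → bits j k Bool.≟ bits j′ k)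
                       (λ same → j′∉M (≡.subst (_∈ M) (bits-injective same) (lookup⇒[]= j M j∈M)))
    ...           | k , differ = minterm≈⊥ {n} {j} {bits {n} j′} k differ

  ⋁φ≈⊤ : ∀ {n m} (M : Fin m → Subset (2 ^ n)) → (∀ j → ∃ λ i → j ∈ M i) →
         ∀ x → ⋁ (λ i → φ (M i) x) ≈ ⊤
  ⋁φ≈⊤ {n} {m} M cover = ≈⊤-from-corners {n} local atCorner
    where
    local : Local (λ x → ⋁ (λ i → φ (M i) x))
    local β x y x≈y = ≈[]-⋁ {m} λ i → φ-local {n} (M i) β x y x≈y
    atCorner : ∀ b → ⋁ (λ i → φ (M i) (corner b)) ≈ ⊤
    atCorner b = ⋁≈⊤ {m} {λ i → φ (M i) (corner b)} (proj₁ (cover (fromBits b)))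
                     (φ-corner≈⊤ {n} {M (proj₁ (cover (fromBits b)))} {b} (proj₂ (cover (fromBits b))))

  -- Partitions of ⊤

  PairwiseDisjoint : ∀ {m} → Vector Carrier m → Set ℓ
  PairwiseDisjoint β = ∀ i i′ → i ≢ i′ → β i ∧ β i′ ≈ ⊥

  disjointify : ∀ {m} → Vector Carrier m → Vector Carrier m
  disjointify γ F.zero    = γ F.zero
  disjointify γ (F.suc i) = ¬ γ F.zero ∧ disjointify (tail γ) i

  ⋁-disjointify : ∀ {m} (γ : Vector Carrier m) → ⋁ (disjointify γ) ≈ ⋁ γ
  ⋁-disjointify {zero}  γ = refl
  ⋁-disjointify {suc m} γ = begin
    γ₀ ∨ ⋁ (λ i → ¬ γ₀ ∧ disjointify (tail γ) i)  ≈⟨ ∨-congˡ (∧-distribˡ-⋁ (¬ γ₀) (disjointify (tail γ))) ⟨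
    γ₀ ∨ (¬ γ₀ ∧ ⋁ (disjointify (tail γ)))        ≈⟨ ∨-congˡ (∧-congˡ (⋁-disjointify (tail γ))) ⟩
    γ₀ ∨ (¬ γ₀ ∧ ⋁ (tail γ))                      ≈⟨ ∨-distribˡ-∧ γ₀ (¬ γ₀) (⋁ (tail γ)) ⟩
    (γ₀ ∨ ¬ γ₀) ∧ (γ₀ ∨ ⋁ (tail γ))               ≈⟨ ∧-congʳ (∨-complementʳ γ₀) ⟩
    ⊤ ∧ (γ₀ ∨ ⋁ (tail γ))                         ≈⟨ ∧-identityˡ _ ⟩
    γ₀ ∨ ⋁ (tail γ)                               ∎
    where
    γ₀ : Carrier
    γ₀ = γ F.zero

  disjointify-disjoint : ∀ {m} (γ : Vector Carrier m) → PairwiseDisjoint (disjointify γ)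
  disjointify-disjoint γ F.zero    F.zero     0≢0 = ⊥-elim (0≢0 ≡.refl)
  disjointify-disjoint γ F.zero    (F.suc i′) _   =
    trans (sym (∧-assoc _ _ _)) (trans (∧-congʳ (∧-complementʳ _)) (∧-zeroˡ _))
  disjointify-disjoint γ (F.suc i) F.zero     _   =
    trans (∧-comm _ _) (trans (sym (∧-assoc _ _ _)) (trans (∧-congʳ (∧-complementʳ _)) (∧-zeroˡ _)))
  disjointify-disjoint γ (F.suc i) (F.suc i′) i≢i′ =
    trans (sym (∧-distribˡ-∧ _ _ _))
          (trans (∧-congˡ (disjointify-disjoint (tail γ) i i′ (i≢i′ ∘ ≡.cong F.suc))) (∧-zeroʳ _))

  disjointify∧¬≈⊥ : ∀ {m} (γ : Vector Carrier m) i → disjointify γ i ∧ ¬ γ i ≈ ⊥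
  disjointify∧¬≈⊥ γ F.zero    = ∧-complementʳ _
  disjointify∧¬≈⊥ γ (F.suc i) =
    trans (∧-assoc _ _ _) (trans (∧-congˡ (disjointify∧¬≈⊥ (tail γ) i)) (∧-zeroʳ _))

  glue : ∀ {m n} → Vector Carrier m → (Fin m → Vector Carrier n) → Vector Carrier n
  glue β u k = ⋁ (λ i → β i ∧ u i k)

  glue-≈[] : ∀ {m n} {β : Vector Carrier m} (u : Fin m → Vector Carrier n) → PairwiseDisjoint β →
             ∀ i k → glue β u k ≈[ β i ] u i k
  glue-≈[] {m} {β = β} u disjoint i k = begin
    β i ∧ ⋁ (λ i′ → β i′ ∧ u i′ k)     ≈⟨ ∧-distribˡ-⋁ {m} (β i) _ ⟩
    ⋁ (λ i′ → β i ∧ (β i′ ∧ u i′ k))   ≈⟨ ⋁-single {m} {λ i′ → β i ∧ (β i′ ∧ u i′ k)} i other ⟩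
    β i ∧ (β i ∧ u i k)                ≈⟨ ∧-assoc _ _ _ ⟨
    (β i ∧ β i) ∧ u i k                ≈⟨ ∧-congʳ (∧-idem _) ⟩
    β i ∧ u i k                        ∎
    where
    other : ∀ i′ → i′ ≢ i → β i ∧ (β i′ ∧ u i′ k) ≈ ⊥
    other i′ i′≢i = trans (sym (∧-assoc _ _ _))
      (trans (∧-congʳ (disjoint i i′ (i′≢i ∘ ≡.sym))) (∧-zeroˡ _))

  Local-glue : ∀ {m n} {β : Vector Carrier m} {G : Vector Carrier n → Carrier} → Local G →
               PairwiseDisjoint β → ⋁ β ≈ ⊤ → ∀ u → G (glue β u) ≈ ⋁ (λ i → β i ∧ G (u i))
  Local-glue {β = β} {G} local disjoint ⋁β≈⊤ u = begin
    G (glue β u)                    ≈⟨ ∧-identityˡ _ ⟨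
    ⊤ ∧ G (glue β u)                ≈⟨ ∧-congʳ ⋁β≈⊤ ⟨
    ⋁ β ∧ G (glue β u)              ≈⟨ ∧-distribʳ-⋁ _ β ⟩
    ⋁ (λ i → β i ∧ G (glue β u))    ≈⟨ ⋁-cong (λ i → local (β i) _ _ (glue-≈[] u disjoint i)) ⟩
    ⋁ (λ i → β i ∧ G (u i))         ∎

  ⋀≈⊥-from-cover : ∀ {m} (a p : Vector Carrier m) → (∀ i → a i ∧ p i ≈ ⊥) → ⋁ p ≈ ⊤ → ⋀ a ≈ ⊥
  ⋀≈⊥-from-cover a p a∧p≈⊥ ⋁p≈⊤ = begin
    ⋀ a                      ≈⟨ ∧-identityʳ _ ⟨
    ⋀ a ∧ ⊤                  ≈⟨ ∧-congˡ ⋁p≈⊤ ⟨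
    ⋀ a ∧ ⋁ p                ≈⟨ ∧-distribˡ-⋁ (⋀ a) p ⟩
    ⋁ (λ i → ⋀ a ∧ p i)      ≈⟨ ⋁≈⊥⁺ vanishes ⟩
    ⊥                        ∎
    where
    vanishes : ∀ i → ⋀ a ∧ p i ≈ ⊥
    vanishes i = begin
      ⋀ a ∧ p i              ≈⟨ ∧-congʳ (⋀∧≈⋀ a i) ⟨
      (⋀ a ∧ a i) ∧ p i      ≈⟨ ∧-assoc _ _ _ ⟩
      ⋀ a ∧ (a i ∧ p i)      ≈⟨ ∧-congˡ (a∧p≈⊥ i) ⟩
      ⋀ a ∧ ⊥                ≈⟨ ∧-zeroʳ _ ⟩
      ⊥                      ∎

  annihilating-point : ∀ {n m} (M : Fin m → Subset (2 ^ n)) → (∀ i → Nonempty (M i)) →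
                       (∀ i i′ → i ≢ i′ → Empty (M i ∩ M i′)) →
                       (a : Vector Carrier m) → ⋀ a ≈ ⊥ → ∃ λ x → ∀ i → a i ∧ φ (M i) x ≈ ⊥
  annihilating-point {n} {m} M nonempty disjoint a ⋀a≈⊥ = glue β u , vanishes
    where
    β : Vector Carrier m
    β = disjointify (λ i → ¬ a i)
    ⋁β≈⊤ : ⋁ β ≈ ⊤
    ⋁β≈⊤ = trans (⋁-disjointify (λ i → ¬ a i)) (trans (sym (¬-⋀ a)) (trans (¬-cong ⋀a≈⊥) ¬⊥≈⊤))
    a∧β≈⊥ : ∀ i → a i ∧ β i ≈ ⊥
    a∧β≈⊥ i = trans (∧-comm _ _) (trans (∧-congˡ (sym (¬-involutive _))) (disjointify∧¬≈⊥ _ i))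
    chosen : Fin m → Fin (2 ^ n)
    chosen i = proj₁ (nonempty i)
    u : Fin m → Vector Carrier n
    u i = corner (bits {n} (chosen i))
    term : ∀ i i′ → a i ∧ (β i′ ∧ φ (M i) (u i′)) ≈ ⊥
    term i i′ with i′ F.≟ i
    ... | yes ≡.refl = trans (sym (∧-assoc _ _ _)) (trans (∧-congʳ (a∧β≈⊥ i)) (∧-zeroˡ _))
    ... | no i′≢i = trans (∧-congˡ (trans (∧-congˡ (φ-corner≈⊥ {n} {M i} chosen∉Mi)) (∧-zeroʳ _))) (∧-zeroʳ _)
      where
      chosen∉Mi : chosen i′ ∉ M i
      chosen∉Mi ∈Mi = disjoint i′ i i′≢i (chosen i′ , x∈p∩q⁺ (proj₂ (nonempty i′) , ∈Mi))
    vanishes : ∀ i → a i ∧ φ (M i) (glue β u) ≈ ⊥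
    vanishes i = begin
      a i ∧ φ (M i) (glue β u)                   ≈⟨ ∧-congˡ (Local-glue (φ-local {n} (M i)) (disjointify-disjoint _) ⋁β≈⊤ u) ⟩
      a i ∧ ⋁ (λ i′ → β i′ ∧ φ (M i) (u i′))     ≈⟨ ∧-distribˡ-⋁ {m} (a i) _ ⟩
      ⋁ (λ i′ → a i ∧ (β i′ ∧ φ (M i) (u i′)))   ≈⟨ ⋁≈⊥⁺ (term i) ⟩
      ⊥                                          ∎

mainTheorem4 : ∀ {c ℓ : Level} (BA : BooleanAlgebra c ℓ) → IsFinite BA →
    let open BooleanAlgebra BA in
    let open BoolFun BA in
    (n₁ n₂ m₁ : ℕ) → n₁ ≥ 1 →
    (M : Fin m₁ → Subset (2 ^ n₁)) →
    (∀ i → Nonempty (M i)) →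
    (∀ i i′ → i ≢ i′ → Empty (M i ∩ M i′)) →
    (∀ j → ∃ λ i → j ∈ M i) →
    (f : (Fin (n₁ + n₂) → Carrier) → Carrier) → IsBooleanFunction f →
    (α : Fin m₁ → (Fin n₂ → Carrier) → Carrier) → (∀ i → IsBooleanFunction (α i)) →
    (∀ (x₁ : Fin n₁ → Carrier) (x₂ : Fin n₂ → Carrier) →
      f (x₁ ++ x₂) ≈ ⋁ (λ i → α i x₂ ∧ φ (M i) x₁)) →
    ((∃ λ (x : Fin (n₁ + n₂) → Carrier) → f x ≈ ⊥)
      ⇔ (∃ λ (x₂ : Fin n₂ → Carrier) → ⋀ (λ i → α i x₂) ≈ ⊥))
mainTheorem4 BA _ n₁ n₂ m₁ _ M nonempty disjoint cover f f-boolean α _ expansion-f =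
  mk⇔ consistent⇒ ⇐consistent
  where
  open BooleanAlgebra BA
  open BoolFun BA
  open BooleanFunctions BA

  consistent⇒ : (∃ λ x → f x ≈ ⊥) → ∃ λ x₂ → ⋀ (λ i → α i x₂) ≈ ⊥
  consistent⇒ (x , fx≈⊥) = x₂ , ⋀≈⊥-from-cover (λ i → α i x₂) (λ i → φ (M i) x₁) (⋁≈⊥⁻ expanded≈⊥) (⋁φ≈⊤ {n₁} M cover x₁)
    where
    x₁ : Fin n₁ → Carrier
    x₁ = take n₁ x
    x₂ : Fin n₂ → Carrier
    x₂ = drop n₁ x
    expanded≈⊥ : ⋁ (λ i → α i x₂ ∧ φ (M i) x₁) ≈ ⊥
    expanded≈⊥ = trans (sym (expansion-f x₁ x₂))
      (trans (BooleanFunction-cong f-boolean (reflexive ∘ take++drop n₁ x)) fx≈⊥)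

  ⇐consistent : (∃ λ x₂ → ⋀ (λ i → α i x₂) ≈ ⊥) → ∃ λ x → f x ≈ ⊥
  ⇐consistent (x₂ , ⋀α≈⊥) with annihilating-point {n₁} M nonempty disjoint _ ⋀α≈⊥
  ... | x₁ , vanishes = x₁ ++ x₂ , trans (expansion-f x₁ x₂) (⋁≈⊥⁺ vanishes)
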